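{- Let $n\ge2$, $d\ge1$, $k\ge1$ be integers. Then $$\sum_{\lambda\in\mathcal{C}_{n,dn-1}}|\lambda|^k=\sum_{I\in\mathcal{B}^-_{d,n-1}}\Bigl(\sum_{(i,j)\in I}\bigl((i-1)n+j\bigr)-\frac{|I|^2}{2}+\frac{|I|}{2}\Bigr)^k.$$
   Context: A partition $\lambda=(\lambda_1\ge\dots\ge\lambda_\ell)$ has size $|\lambda|=\sum_i\lambda_i$. The hook length of a box of its Young diagram is the number of boxes directly to its right, directly below it, plus the box itself. For a positive integer $t$, $\lambda$ is a $t$-core if none of its hook lengths is divisible by $t$; an $(s,t)$-core is both an $s$-core and a $t$-core. $\mathcal{C}_{n,dn-1}$ is the set of $(n,dn-1)$-core partitions with distinct parts. For integers $d\ge1$, $N\ge0$ let $\mathcal{A}_{d,N}=\{(i,j):1\le i\le d,\ 1\le j\le N\}$. A subset $I\subseteq\mathcal{A}_{d,N}$ is nice if (1) $(i+1,j)\in I$ with $i\ge1$ implies $(i,j)\in I$, and (2) $(1,j)\in I$ with $1\le j\le N-1$ implies $(1,j+1)\notin I$. $\mathcal{B}^-_{d,N}$ denotes the set of nice subsets $I$ of $\mathcal{A}_{d,N}$ with $(d,N)\notin I$, and $|I|$ the cardinality of $I$. -}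

module Defs where

open import Data.Bool using (Bool; true; false; if_then_else_)
open import Data.Nat using (ℕ; zero; suc; _+_; _*_; _∸_; _≤_; _<_; _>_; _≥_; _<?_)
open import Data.Nat.Divisibility using (_∣_)
open import Data.Nat.DivMod using (_/_)
open import Data.Integer as ℤ using (ℤ; +_; _-_)
open import Data.Fin using (Fin; toℕ)
open import Data.List as List using (List; []; _∷_; length; lookup; filter)
open import Data.Nat.ListAction using (sum)
open import Data.List.Relation.Unary.All using (All)
open import Data.List.Relation.Unary.Linked using (Linked)
open import Data.List.Relation.Unary.Unique.Propositional using (Unique)
open import Data.List.Membership.Propositional using (_∈_)
open import Data.Vec as Vec using (Vec; []; _∷_)
open import Data.Product using (_×_)
open import Function.Bundles using (_⇔_)
open import Relation.Nullary using (¬_)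
open import Relation.Binary.PropositionalEquality using (_≡_)

IsPartition : List ℕ → Set
IsPartition μ = Linked _≥_ μ × All (0 <_) μ

DistinctParts : List ℕ → Set
DistinctParts μ = Linked _>_ μ

size : List ℕ → ℕ
size = sum

-- μ'_c : number of parts > c  (length of column c, 0-indexed)
colLen : List ℕ → ℕ → ℕ
colLen μ c = length (filter (c <?_) μ)

-- hook length of box in row r (0-indexed), column c (0-indexed), c < λ_r :
-- arm + leg + 1
hook : (μ : List ℕ) → Fin (length μ) → ℕ → ℕ
hook μ r c = (lookup μ r ∸ suc c) + (colLen μ c ∸ suc (toℕ r)) + 1

IsCore : ℕ → List ℕ → Set
IsCore t μ = ∀ (r : Fin (length μ)) (c : ℕ) → c < lookup μ r → ¬ (t ∣ hook μ r c)

InC : ℕ → ℕ → List ℕ → Set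
InC n d μ = IsPartition μ × DistinctParts μ × IsCore n μ × IsCore (d * n ∸ 1) μ

-- Subsets I of A_{d,N} as d×N Boolean matrices:
-- row i (0-indexed), column j (0-indexed) is true iff (i+1, j+1) ∈ I.

Subset : ℕ → ℕ → Set
Subset d N = Vec (Vec Bool N) d

memRow : ∀ {N} → Vec Bool N → ℕ → Bool
memRow []       _             = false
memRow (b ∷ bs) zero          = false
memRow (b ∷ bs) (suc zero)    = b
memRow (b ∷ bs) (suc (suc j)) = memRow bs (suc j)

-- mem I i j  ≡ true  iff  (i , j) ∈ I   (1-based indices; false outside A_{d,N})
mem : ∀ {d N} → Subset d N → ℕ → ℕ → Bool
mem []       _             j = false
mem (r ∷ rs) zero          j = false
mem (r ∷ rs) (suc zero)    j = memRow r j
mem (r ∷ rs) (suc (suc i)) j = mem rs (suc i) j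

Nice : ∀ {d N} → Subset d N → Set
Nice {d} {N} I =
  (∀ i j → 1 ≤ i → mem I (suc i) j ≡ true → mem I i j ≡ true) ×
  (∀ j → 1 ≤ j → j ≤ N ∸ 1 → mem I 1 j ≡ true → mem I 1 (suc j) ≡ false)

InB : (d N : ℕ) → Subset d N → Set
InB d N I = Nice I × mem I d N ≡ false

cardRow : ∀ {N} → Vec Bool N → ℕ
cardRow []       = 0
cardRow (b ∷ bs) = (if b then 1 else 0) + cardRow bs

card : ∀ {d N} → Subset d N → ℕ
card []       = 0
card (r ∷ rs) = cardRow r + card rs

-- Σ_{(i,j) ∈ I} ((i-1) n + j), 1-based (i,j); here i0 = i-1, j0 = j-1
weightRow : ∀ {N} → ℕ → ℕ → ℕ → Vec Bool N → ℕ
weightRow n i0 j0 []       = 0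
weightRow n i0 j0 (b ∷ bs) = (if b then i0 * n + suc j0 else 0) + weightRow n i0 (suc j0) bs

weightFrom : ∀ {d N} → ℕ → ℕ → Subset d N → ℕ
weightFrom n i0 []       = 0
weightFrom n i0 (r ∷ rs) = weightRow n i0 0 r + weightFrom n (suc i0) rs

weight : ∀ {d N} → ℕ → Subset d N → ℕ
weight n I = weightFrom n 0 I

-- Σ_{(i,j)∈I} ((i-1)n+j) - |I|²/2 + |I|/2 ; note |I|²/2 - |I|/2 = (|I|² - |I|)/2 is an integer
rhsTerm : ∀ {d N} → ℕ → Subset d N → ℤ
rhsTerm n I = + weight n I - + ((card I * card I ∸ card I) / 2)

Enumerates : {A : Set} → (A → Set) → List A → Set
Enumerates {A} P L = Unique L × (∀ (x : A) → (x ∈ L) ⇔ P x)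

sumℤ : List ℤ → ℤ
sumℤ = List.foldr ℤ._+_ (+ 0)

module Submission where

-- The proof is a size-preserving bijection F : B⁻_{d,n-1} → C_{n,dn-1}, built
-- from β-sets (sets of first-column hook lengths).
--  * Hooks and β-sets.  A partition with distinct parts is a t-core iff its
--    β-set H is t-closed (v ∈ H, v ≥ t ⇒ v - t ∈ H); the proof peels off the
--    first row, whose hook lengths are h - k for the gaps k < h of the rest.
--  * Strict partitions are exactly the unβ-images of "separated" sets (no two
--    consecutive numbers), and |μ| = Σ β(μ) - (0 + 1 + ⋯ + (ℓ(μ) - 1)).
--  * A Boolean d × (n-1) matrix I has the cell set {(i-1)n + j : (i,j) ∈ I}.
--    For μ ∈ C the β-set lies below t = dn - 1 (else it would contain two
--    consecutive numbers) and avoids multiples of n, so it is such a cell set;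
--    niceness of I translates into n-closure and separation of its cells.
--  * Hence F I = unβ (cells of I) is a bijection, and |F I| is the summand.
-- Finally, any two enumerations of the same finite set are permutations of one
-- another, so both sums are independent of the enumerations chosen.

open import Defs
open import Data.Bool using (Bool; true; false)
import Data.Bool as Bool
open import Data.Nat
  using (ℕ; zero; suc; _+_; _*_; _∸_; _≤_; _<_; _>_; _≥_; z≤n; s≤s; s≤s⁻¹; z<s; _<?_; _≤?_)
open import Data.Nat.Properties
open import Data.Nat.DivMod using (_/_; _%_; m*n/n≡m; m%n<n; m≡m%n+[m/n]*n)
open import Data.Nat.Divisibility using (_∣_; divides)
open import Data.Nat.ListAction using (sum)
open import Data.Nat.ListAction.Properties using (sum-++)
open import Data.Nat.Tactic.RingSolver using (solve-∀)
open import Data.Integer as ℤ using (ℤ; _^_; _⊖_)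
import Data.Integer.Properties as ℤ
open import Data.Fin using (toℕ) renaming (zero to fzero; suc to fsuc)
open import Data.Vec as Vec using (Vec; []; _∷_)
import Data.Vec.Properties as Vec
open import Data.List as List
  using (List; []; _∷_; [_]; _++_; map; length; filter; cartesianProduct)
import Data.List.Properties as List
open import Data.List.Membership.Propositional using (_∈_; _∉_)
open import Data.List.Membership.DecPropositional _≟_ using (_∈?_)
open import Data.List.Membership.Propositional.Properties
  using (∈-map⁺; ∈-map⁻; ∈-filter⁺; ∈-filter⁻; ∈-cartesianProduct⁺; ∈-lookup;
         ∈-++⁺ˡ; ∈-++⁺ʳ; ∈-++⁻)
open import Data.List.Membership.Propositional.Properties.WithK using (unique∧set⇒bag)
open import Data.List.Relation.Unary.All as All using (All; []; _∷_)
open import Data.List.Relation.Unary.Any using (here; there)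
open import Data.List.Relation.Unary.AllPairs as AllPairs using (AllPairs; []; _∷_)
import Data.List.Relation.Unary.AllPairs.Properties as AllPairs
open import Data.List.Relation.Unary.Linked as Linked using (Linked; []; [-]; _∷_)
open import Data.List.Relation.Unary.Linked.Properties using (Linked⇒AllPairs; AllPairs⇒Linked)
open import Data.List.Relation.Unary.Unique.Propositional using (Unique)
import Data.List.Relation.Unary.Unique.Propositional.Properties as Unique
open import Data.List.Relation.Unary.Sorted.TotalOrder.Properties using (↗↭↗⇒≋)
open import Data.List.Relation.Binary.Pointwise using (Pointwise-≡⇒≡)
open import Data.List.Relation.Binary.BagAndSetEquality using (∼bag⇒↭)
open import Data.List.Relation.Binary.Permutation.Propositional using (_↭_; ↭⇒↭ₛ)
open import Data.List.Relation.Binary.Permutation.Propositional.Properties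
  using () renaming (map⁺ to ↭-map)
open import Data.List.Relation.Binary.Permutation.Setoid.Properties using (foldr-commMonoid)
open import Data.Product using (_×_; _,_; proj₁; proj₂; ∃; ∃₂)
open import Data.Sum using (inj₁; inj₂)
open import Data.Empty using (⊥; ⊥-elim)
open import Algebra.Bundles using (CommutativeMonoid)
open import Function using (_∘_)
open import Function.Bundles using (_⇔_; mk⇔; Equivalence)
open import Relation.Nullary using (¬_; yes; no; Dec; does; proof; contradiction)
open import Relation.Nullary.Decidable using (map′; _×-dec_; _→-dec_; dec-true; dec-false)
open import Relation.Nullary.Reflects using (Reflects; invert)
open import Relation.Binary.Definitions using (tri<; tri≈; tri>)
open import Relation.Binary.Properties.TotalOrder ≤-totalOrder using (≥-totalOrder)
open import Relation.Binary.PropositionalEquality hiding ([_])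

open Equivalence using (to; from)

StrictlyDecreasing : List ℕ → Set
StrictlyDecreasing = AllPairs _>_

linked⇒decreasing : ∀ {xs} → Linked _>_ xs → StrictlyDecreasing xs
linked⇒decreasing = Linked⇒AllPairs (λ b<a c<b → <-trans c<b b<a)

decreasing-ext : ∀ {xs ys} → StrictlyDecreasing xs → StrictlyDecreasing ys →
                 (∀ {v} → v ∈ xs ⇔ v ∈ ys) → xs ≡ ys
decreasing-ext dx dy same =
  Pointwise-≡⇒≡ (↗↭↗⇒≋ ≥-totalOrder (sorted dx) (sorted dy)
                  (↭⇒↭ₛ (∼bag⇒↭ (unique∧set⇒bag (unique dx) (unique dy) same))))
  where
  sorted : ∀ {xs} → StrictlyDecreasing xs → Linked _≥_ xs
  sorted = Linked.map <⇒≤ ∘ AllPairs⇒Linked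
  unique : ∀ {xs} → StrictlyDecreasing xs → Unique xs
  unique = AllPairs.map (λ x>y x≡y → <-irrefl (sym x≡y) x>y)

-- The β-set of a partition μ₁ ≥ μ₂ ≥ … ≥ μ_ℓ: its first-column hook lengths
-- μ_i + (ℓ - i).
β : List ℕ → List ℕ
β []       = []
β (x ∷ xs) = x + length xs ∷ β xs

Closed : ℕ → List ℕ → Set
Closed t H = ∀ v → v ∈ H → t ≤ v → v ∸ t ∈ H

closed-∸* : ∀ {t H} → Closed t H → ∀ q {v k} → v ∈ H → v ≡ k + q * t → k ∈ H
closed-∸* {t} {H} cl zero    {v} {k} v∈ v≡ = subst (_∈ H) (trans v≡ (+-identityʳ k)) v∈
closed-∸* {t} {H} cl (suc q) {v} {k} v∈ v≡ =
  closed-∸* cl q (cl v v∈ t≤v) (trans (cong (_∸ t) v≡′) (m+n∸n≡m (k + q * t) t))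
  where
  v≡′ : v ≡ (k + q * t) + t
  v≡′ = trans v≡ (trans (cong (k +_) (+-comm t (q * t))) (sym (+-assoc k (q * t) t)))
  t≤v : t ≤ v
  t≤v = subst (t ≤_) (sym v≡′) (m≤n+m t _)

colLen-∷< : ∀ {c y} ys → c < y → colLen (y ∷ ys) c ≡ suc (colLen ys c)
colLen-∷< {c} ys c<y = cong length (List.filter-accept (c <?_) c<y)

colLen-∷≥ : ∀ {c y} ys → y ≤ c → colLen (y ∷ ys) c ≡ colLen ys c
colLen-∷≥ {c} ys y≤c = cong length (List.filter-reject (c <?_) (≤⇒≯ y≤c))

colLen-beyond : ∀ {c x} ys → All (_< x) ys → x ≤ c → colLen ys c ≡ 0
colLen-beyond []       []         _   = refl
colLen-beyond (y ∷ ys) (y<x ∷ ys<x) x≤c =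
  trans (colLen-∷≥ ys (≤-trans (<⇒≤ y<x) x≤c)) (colLen-beyond ys ys<x x≤c)

colLen≤length : ∀ c ys → colLen ys c ≤ length ys
colLen≤length c ys = List.length-filter (c <?_) ys

β-bounded : ∀ x ys → All (_< x) ys → All (_< x + length ys) (β ys)
β-bounded x []       []         = []
β-bounded x (y ∷ ys) (y<x ∷ ys<x) =
  <-≤-trans (+-monoˡ-< (length ys) y<x) x+ℓ≤
  ∷ All.map (λ v< → <-≤-trans v< x+ℓ≤) (β-bounded x ys ys<x)
  where
  x+ℓ≤ : x + length ys ≤ x + suc (length ys)
  x+ℓ≤ = +-monoʳ-≤ x (n≤1+n (length ys))

∈β⇒≤head : ∀ {k y} ys → All (_< y) ys → k ∈ β (y ∷ ys) → k ≤ y + length ys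
∈β⇒≤head ys ys<y (here refl) = ≤-refl
∈β⇒≤head {y = y} ys ys<y (there k∈) = <⇒≤ (All.lookup (β-bounded y ys ys<y) k∈)

colLen-∷-beyond : ∀ {c y} ys → All (_< y) ys → y ≤ c → colLen (y ∷ ys) c ≡ 0
colLen-∷-beyond ys ys<y y≤c = trans (colLen-∷≥ ys y≤c) (colLen-beyond ys ys<y y≤c)

-- Adding a part y > c to a partition adds one box to column c and one to the
-- length, so the column equation k + μ'_c = c + ℓ(μ) is unchanged.
column-∷ : ∀ {k c y} ys → c < y →
           (k + colLen (y ∷ ys) c ≡ c + length (y ∷ ys)) ⇔
           (k + colLen ys c ≡ c + length ys)
column-∷ {k} {c} ys c<y = mk⇔
  (λ eq → suc-injective (trans (sym (+-suc k _)) (trans (cong (k +_) (sym (colLen-∷< ys c<y)))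
                                                  (trans eq (+-suc c _)))))
  (λ eq → trans (cong (k +_) (colLen-∷< ys c<y))
                (trans (+-suc k _) (trans (cong suc eq) (sym (+-suc c _)))))

column⇒∉β : ∀ xs → StrictlyDecreasing xs → ∀ c k →
            k + colLen xs c ≡ c + length xs → k ∉ β xs
column⇒∉β (y ∷ ys) (ys<y ∷ sd) c k eq k∈ with c <? y
... | yes c<y with k∈
...   | here k≡  = <-irrefl k≡ (≤-<-trans k≤ (+-monoˡ-< (length ys) c<y))
  where
  k≤ : k ≤ c + length ys
  k≤ = subst (k ≤_) (to (column-∷ ys c<y) eq) (m≤m+n k _)
...   | there k∈′ = column⇒∉β ys sd c k (to (column-∷ ys c<y) eq) k∈′
column⇒∉β (y ∷ ys) (ys<y ∷ sd) c k eq k∈ | no c≮y = <⇒≱ k> (∈β⇒≤head ys ys<y k∈)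
  where
  y≤c : y ≤ c
  y≤c = ≮⇒≥ c≮y
  k> : y + length ys < k
  k> = begin-strict
    y + length ys                 ≤⟨ +-monoˡ-≤ (length ys) y≤c ⟩
    c + length ys                 <⟨ +-monoʳ-< c (n<1+n (length ys)) ⟩
    c + length (y ∷ ys)           ≡⟨ eq ⟨
    k + colLen (y ∷ ys) c         ≡⟨ cong (k +_) (colLen-∷-beyond ys ys<y y≤c) ⟩
    k + 0                         ≡⟨ +-identityʳ k ⟩
    k                             ∎
    where open ≤-Reasoning

∉β⇒column : ∀ xs → StrictlyDecreasing xs → ∀ k → k ∉ β xs →
            ∃ λ c → k + colLen xs c ≡ c + length xs
∉β⇒column []       _           k _  = k , refl
∉β⇒column (y ∷ ys) (ys<y ∷ sd) k k∉ with <-cmp k (y + length ys)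
... | tri≈ _ k≡ _ = ⊥-elim (k∉ (here k≡))
... | tri< k< _ _ with ∉β⇒column ys sd k (k∉ ∘ there)
...   | c , eq with c <? y
...     | yes c<y = c , from (column-∷ ys c<y) eq
...     | no c≮y  = ⊥-elim (<⇒≱ k< (begin
          y + length ys          ≤⟨ +-monoˡ-≤ (length ys) (≮⇒≥ c≮y) ⟩
          c + length ys          ≡⟨ eq ⟨
          k + colLen ys c        ≡⟨ cong (k +_) (colLen-beyond ys ys<y (≮⇒≥ c≮y)) ⟩
          k + 0                  ≡⟨ +-identityʳ k ⟩
          k                      ∎))
  where open ≤-Reasoning
∉β⇒column (y ∷ ys) (ys<y ∷ sd) k k∉ | tri> _ _ k> = c , (begin
    k + colLen (y ∷ ys) c  ≡⟨ cong (k +_) (colLen-∷-beyond ys ys<y y≤c) ⟩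
    k + 0                  ≡⟨ +-identityʳ k ⟩
    k                      ≡⟨ m∸n+n≡m ℓ<k ⟨
    c + length (y ∷ ys)    ∎)
  where
  open ≡-Reasoning
  ℓ<k : length ys < k
  ℓ<k = ≤-<-trans (m≤n+m (length ys) y) k>
  c : ℕ
  c = k ∸ suc (length ys)
  y≤c : y ≤ c
  y≤c = m+n≤o⇒m≤o∸n y (subst (_≤ k) (sym (+-suc y (length ys))) k>)

-- The hook length of the box in column c of a row x placed on top of the
-- partition xs (arm x - c - 1, leg μ'_c).
firstRowHook : ℕ → List ℕ → ℕ → ℕ
firstRowHook x xs c = (x ∸ suc c) + colLen xs c + 1

firstRowHook+ : ∀ x xs c k → c < x → k + colLen xs c ≡ c + length xs →
                firstRowHook x xs c + k ≡ x + length xs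
firstRowHook+ x xs c k c<x eq = begin
  (x ∸ suc c) + colLen xs c + 1 + k      ≡⟨ move-k (x ∸ suc c) (colLen xs c) k ⟩
  (x ∸ suc c) + 1 + (k + colLen xs c)    ≡⟨ cong (λ a → (x ∸ suc c) + 1 + a) eq ⟩
  (x ∸ suc c) + 1 + (c + length xs)      ≡⟨ absorb-c (x ∸ suc c) c (length xs) ⟩
  (x ∸ suc c) + suc c + length xs        ≡⟨ cong (_+ length xs) (m∸n+n≡m c<x) ⟩
  x + length xs                          ∎
  where
  open ≡-Reasoning
  move-k : ∀ r a k → r + a + 1 + k ≡ r + 1 + (k + a)
  move-k = solve-∀
  absorb-c : ∀ r c ℓ → r + 1 + (c + ℓ) ≡ r + suc c + ℓ
  absorb-c = solve-∀

firstRowHook⇒gap : ∀ x xs → StrictlyDecreasing xs → ∀ c → c < x →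
                   ∃ λ k → k ∉ β xs × firstRowHook x xs c + k ≡ x + length xs
firstRowHook⇒gap x xs sd c c<x = k , column⇒∉β xs sd c k eq , firstRowHook+ x xs c k c<x eq
  where
  k : ℕ
  k = c + length xs ∸ colLen xs c
  eq : k + colLen xs c ≡ c + length xs
  eq = m∸n+n≡m (≤-trans (colLen≤length c xs) (m≤n+m (length xs) c))

gap⇒firstRowHook : ∀ x xs → StrictlyDecreasing xs → All (_< x) xs → ∀ k → k ∉ β xs →
                   k < x + length xs →
                   ∃ λ c → c < x × firstRowHook x xs c + k ≡ x + length xs
gap⇒firstRowHook x xs sd xs<x k k∉ k< with ∉β⇒column xs sd k k∉
... | c , eq with c <? x
...   | yes c<x = c , c<x , firstRowHook+ x xs c k c<x eq
...   | no c≮x  = ⊥-elim (<⇒≱ k< (begin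
        x + length xs      ≤⟨ +-monoˡ-≤ (length xs) (≮⇒≥ c≮x) ⟩
        c + length xs      ≡⟨ eq ⟨
        k + colLen xs c    ≡⟨ cong (k +_) (colLen-beyond xs xs<x (≮⇒≥ c≮x)) ⟩
        k + 0              ≡⟨ +-identityʳ k ⟩
        k                  ∎))
  where open ≤-Reasoning

FirstRowCore : ℕ → ℕ → List ℕ → Set
FirstRowCore t x xs = ∀ c → c < x → ¬ t ∣ firstRowHook x xs c

-- No first-row hook equals t, so h - t (if defined) is not a gap of β xs.
firstRowCore⇒step : ∀ t x xs → 1 ≤ t → StrictlyDecreasing xs → All (_< x) xs →
                    FirstRowCore t x xs → t ≤ x + length xs → x + length xs ∸ t ∈ β xs
firstRowCore⇒step t x xs 1≤t sd xs<x core t≤h with x + length xs ∸ t ∈? β xs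
... | yes k∈ = k∈
... | no k∉
  with gap⇒firstRowHook x xs sd xs<x (x + length xs ∸ t) k∉ (∸-monoʳ-< 1≤t t≤h)
...   | c , c<x , eq = ⊥-elim (core c c<x (divides 1 hook≡t))
  where
  hook≡t : firstRowHook x xs c ≡ 1 * t
  hook≡t = trans (+-cancelʳ-≡ _ _ _ (trans eq (trans (sym (m∸n+n≡m t≤h)) (+-comm _ t))))
                 (sym (*-identityˡ t))

-- Conversely, if β xs is t-closed and contains h - t, then no first-row hook
-- is a multiple q t: that would make the gap h - q t lie in β xs.
step⇒firstRowCore : ∀ t x xs → StrictlyDecreasing xs → Closed t (β xs) →
                    (t ≤ x + length xs → x + length xs ∸ t ∈ β xs) → FirstRowCore t x xs
step⇒firstRowCore t x xs sd cl step c c<x (divides zero eq) = 1+n≢0 (trans (+-comm 1 _) eq)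
step⇒firstRowCore t x xs sd cl step c c<x (divides (suc q) eq)
  with firstRowHook⇒gap x xs sd c c<x
... | k , k∉ , hook+k = k∉ (closed-∸* cl q (step t≤h) h∸t≡)
  where
  h : ℕ
  h = x + length xs
  h≡ : h ≡ (k + q * t) + t
  h≡ = trans (sym hook+k) (trans (cong (_+ k) eq) (rearrange k q t))
    where
    rearrange : ∀ k q t → (t + q * t) + k ≡ (k + q * t) + t
    rearrange = solve-∀
  t≤h : t ≤ h
  t≤h = subst (t ≤_) (sym h≡) (m≤n+m t _)
  h∸t≡ : h ∸ t ≡ k + q * t
  h∸t≡ = trans (cong (_∸ t) h≡) (m+n∸n≡m _ t)

-- Hooks of x ∷ xs: in the first row they are the first-row hooks, and below it
-- they are the hooks of xs (every box of a lower row lies in a column c < x).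
hook-head : ∀ {c x} xs → c < x → hook (x ∷ xs) fzero c ≡ firstRowHook x xs c
hook-head {c} {x} xs c<x = cong (λ a → (x ∸ suc c) + (a ∸ 1) + 1) (colLen-∷< xs c<x)

hook-tail : ∀ {c x} xs r → c < x → hook (x ∷ xs) (fsuc r) c ≡ hook xs r c
hook-tail {c} xs r c<x =
  cong (λ a → (List.lookup xs r ∸ suc c) + (a ∸ suc (suc (toℕ r))) + 1) (colLen-∷< xs c<x)

core-∷ : ∀ t x xs → All (_< x) xs →
         IsCore t (x ∷ xs) ⇔ (FirstRowCore t x xs × IsCore t xs)
core-∷ t x xs xs<x = mk⇔ split join
  where
  below : ∀ {c} r → c < List.lookup xs r → c < x
  below r c<y = <-trans c<y (All.lookup xs<x (∈-lookup r))
  split : IsCore t (x ∷ xs) → FirstRowCore t x xs × IsCore t xs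
  split core =
    (λ c c<x → core fzero c c<x ∘ subst (t ∣_) (sym (hook-head xs c<x))) ,
    (λ r c c<y → core (fsuc r) c c<y ∘ subst (t ∣_) (sym (hook-tail xs r (below r c<y))))
  join : FirstRowCore t x xs × IsCore t xs → IsCore t (x ∷ xs)
  join (first , _) fzero    c c<x = first c c<x ∘ subst (t ∣_) (hook-head xs c<x)
  join (_ , rest)  (fsuc r) c c<y = rest r c c<y ∘ subst (t ∣_) (hook-tail xs r (below r c<y))

closed-∷ : ∀ t h H → 1 ≤ t → All (_< h) H →
           Closed t (h ∷ H) ⇔ ((t ≤ h → h ∸ t ∈ H) × Closed t H)
closed-∷ t h H 1≤t H<h = mk⇔ split join
  where
  split : Closed t (h ∷ H) → (t ≤ h → h ∸ t ∈ H) × Closed t H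
  split cl = step , rest
    where
    step : t ≤ h → h ∸ t ∈ H
    step t≤h with cl h (here refl) t≤h
    ... | here h∸t≡h = ⊥-elim (<-irrefl h∸t≡h (∸-monoʳ-< 1≤t t≤h))
    ... | there h∸t∈ = h∸t∈
    rest : Closed t H
    rest v v∈ t≤v with cl v (there v∈) t≤v
    ... | here v∸t≡h = ⊥-elim (<-irrefl v∸t≡h (≤-<-trans (m∸n≤m v t) (All.lookup H<h v∈)))
    ... | there v∸t∈ = v∸t∈
  join : (t ≤ h → h ∸ t ∈ H) × Closed t H → Closed t (h ∷ H)
  join (step , _)  v (here refl) t≤v = there (step t≤v)
  join (_ , rest)  v (there v∈)  t≤v = there (rest v v∈ t≤v)

core⇔closed : ∀ t → 1 ≤ t → ∀ μ → StrictlyDecreasing μ →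
              IsCore t μ ⇔ Closed t (β μ)
core⇔closed t 1≤t []       _           = mk⇔ (λ _ _ ()) (λ _ ())
core⇔closed t 1≤t (x ∷ xs) (xs<x ∷ sd) = mk⇔
  (λ core → let (first , rest) = to (core-∷ t x xs xs<x) core in
     from (closed-∷ t (x + length xs) (β xs) 1≤t β<h)
       (firstRowCore⇒step t x xs 1≤t sd xs<x first , to (core⇔closed t 1≤t xs sd) rest))
  (λ cl → let (step , rest) = to (closed-∷ t (x + length xs) (β xs) 1≤t β<h) cl in
     from (core-∷ t x xs xs<x)
       (step⇒firstRowCore t x xs sd rest step , from (core⇔closed t 1≤t xs sd) rest))
  where
  β<h : All (_< x + length xs) (β xs)
  β<h = β-bounded x xs xs<x

StrictPartition : List ℕ → Set
StrictPartition μ = Linked _>_ μ × All (0 <_) μ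

-- Lists in which each entry exceeds the next one by at least two; with
-- positive entries these are the β-sets of strict partitions.
Separated : List ℕ → Set
Separated = Linked (λ a b → suc b < a)

SeparatedSet : List ℕ → Set
SeparatedSet H = Separated H × All (0 <_) H

unβ : List ℕ → List ℕ
unβ []       = []
unβ (h ∷ hs) = h ∸ length hs ∷ unβ hs

length-β : ∀ μ → length (β μ) ≡ length μ
length-β []       = refl
length-β (x ∷ xs) = cong suc (length-β xs)

length-unβ : ∀ H → length (unβ H) ≡ length H
length-unβ []       = refl
length-unβ (h ∷ hs) = cong suc (length-unβ hs)

unβ-β : ∀ μ → unβ (β μ) ≡ μ
unβ-β []       = refl
unβ-β (x ∷ xs) =
  cong₂ _∷_ (trans (cong (x + length xs ∸_) (length-β xs)) (m+n∸n≡m x (length xs)))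
            (unβ-β xs)

length<head : ∀ h hs → SeparatedSet (h ∷ hs) → length hs < h
length<head h []        (_ , 0<h ∷ _) = 0<h
length<head h (h′ ∷ hs) (gap ∷ sep , _ ∷ pos) =
  ≤-trans (s≤s (length<head h′ hs (sep , pos))) (≤-trans (n≤1+n (suc h′)) gap)

β-unβ : ∀ H → SeparatedSet H → β (unβ H) ≡ H
β-unβ []       _           = refl
β-unβ (h ∷ hs) (sep , pos) = cong₂ _∷_
  (trans (cong (h ∸ length hs +_) (length-unβ hs))
         (m∸n+n≡m (<⇒≤ (length<head h hs (sep , pos)))))
  (β-unβ hs (Linked.tail sep , All.tail pos))

β-separated : ∀ μ → StrictPartition μ → SeparatedSet (β μ)
β-separated []           _                       = [] , []
β-separated (x ∷ [])     (_ , 0<x ∷ _)           = [-] , (≤-trans 0<x (m≤m+n x 0) ∷ [])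
β-separated (x ∷ y ∷ ys) (y<x ∷ dec , 0<x ∷ pos) with β-separated (y ∷ ys) (dec , pos)
... | sep , pos′ = gap ∷ sep , ≤-trans 0<x (m≤m+n x _) ∷ pos′
  where
  gap : suc (suc (y + length ys)) ≤ x + suc (length ys)
  gap = subst (suc (suc (y + length ys)) ≤_) (sym (+-suc x (length ys)))
              (s≤s (+-monoˡ-≤ (length ys) y<x))

unβ-strict : ∀ H → SeparatedSet H → StrictPartition (unβ H)
unβ-strict H sepH = decreasing H sepH , positive H sepH
  where
  decreasing : ∀ H → SeparatedSet H → Linked _>_ (unβ H)
  decreasing []            _                   = []
  decreasing (h ∷ [])      _                   = [-]
  decreasing (h ∷ h′ ∷ hs) (gap ∷ sep , _ ∷ pos) =
    m+n≤o⇒m≤o∸n (suc (h′ ∸ length hs)) (≤-trans (≤-reflexive e) gap)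
    ∷ decreasing (h′ ∷ hs) (sep , pos)
    where
    e : suc (h′ ∸ length hs) + suc (length hs) ≡ suc (suc h′)
    e = trans (cong suc (+-suc (h′ ∸ length hs) (length hs)))
              (cong (suc ∘ suc) (m∸n+n≡m (<⇒≤ (length<head h′ hs (sep , pos)))))
  positive : ∀ H → SeparatedSet H → All (0 <_) (unβ H)
  positive []       _                 = []
  positive (h ∷ hs) (sep , 0<h ∷ pos) =
    m<n⇒0<n∸m (length<head h hs (sep , 0<h ∷ pos)) ∷ positive hs (Linked.tail sep , pos)

separated⇒decreasing : ∀ {H} → SeparatedSet H → StrictlyDecreasing H
separated⇒decreasing (sep , _) =
  linked⇒decreasing (Linked.map (λ gap → <-trans (n<1+n _) gap) sep)

NoConsecutive : List ℕ → Set
NoConsecutive H = ∀ v → v ∈ H → suc v ∈ H → ⊥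

separated⇒noConsecutive : ∀ H → Separated H → NoConsecutive H
separated⇒noConsecutive H sep =
  go H (Linked⇒AllPairs (λ b<a c<b → <-trans c<b (<-trans (n<1+n _) b<a)) sep)
  where
  go : ∀ H → AllPairs (λ a b → suc b < a) H → NoConsecutive H
  go (h ∷ hs) (_     ∷ _) v (here refl) (here 1+v≡v)  = <-irrefl (sym 1+v≡v) (n<1+n v)
  go (h ∷ hs) (below ∷ _) v (here refl) (there 1+v∈) =
    <-asym (All.lookup below 1+v∈) (<-trans (n<1+n v) (n<1+n _))
  go (h ∷ hs) (below ∷ _) v (there v∈)  (here refl)  = <-irrefl refl (All.lookup below v∈)
  go (h ∷ hs) (_ ∷ rest)  v (there v∈)  (there 1+v∈) = go hs rest v v∈ 1+v∈

noConsecutive⇒separated : ∀ H → StrictlyDecreasing H → NoConsecutive H → Separated H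
noConsecutive⇒separated []            _                    _       = []
noConsecutive⇒separated (h ∷ [])      _                    _       = [-]
noConsecutive⇒separated (h ∷ h′ ∷ hs) ((h′<h ∷ _) ∷ dec) noCons =
  ≤∧≢⇒< h′<h (λ 1+h′≡h → noCons h′ (there (here refl)) (here 1+h′≡h))
  ∷ noConsecutive⇒separated (h′ ∷ hs) dec (λ v v∈ 1+v∈ → noCons v (there v∈) (there 1+v∈))

triangle : ℕ → ℕ
triangle zero    = 0
triangle (suc c) = c + triangle c

sum-β : ∀ μ → sum (β μ) ≡ sum μ + triangle (length μ)
sum-β []       = refl
sum-β (x ∷ xs) = trans (cong (x + length xs +_) (sum-β xs)) (rearrange x (length xs) (sum xs) _)
  where
  rearrange : ∀ x ℓ s t → (x + ℓ) + (s + t) ≡ (x + s) + (ℓ + t)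
  rearrange = solve-∀

triangle-closed-form : ∀ c → (c * c ∸ c) / 2 ≡ triangle c
triangle-closed-form c = begin
  (c * c ∸ c) / 2                ≡⟨ cong (λ a → (a ∸ c) / 2) (twice c) ⟨
  (triangle c * 2 + c ∸ c) / 2   ≡⟨ cong (_/ 2) (m+n∸n≡m _ c) ⟩
  triangle c * 2 / 2             ≡⟨ m*n/n≡m (triangle c) 2 ⟩
  triangle c                     ∎
  where
  open ≡-Reasoning
  twice : ∀ c → triangle c * 2 + c ≡ c * c
  twice zero    = refl
  twice (suc c) = begin
    (c + triangle c) * 2 + suc c    ≡⟨ expand c (triangle c) ⟩
    2 * c + (triangle c * 2 + c) + 1 ≡⟨ cong (λ a → 2 * c + a + 1) (twice c) ⟩
    2 * c + c * c + 1               ≡⟨ square c ⟩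
    suc c * suc c                   ∎
    where
    expand : ∀ c t → (c + t) * 2 + suc c ≡ 2 * c + (t * 2 + c) + 1
    expand = solve-∀
    square : ∀ c → 2 * c + c * c + 1 ≡ suc c * suc c
    square = solve-∀

divMod-unique : ∀ n i i′ a b → i * n + a ≡ i′ * n + b → a < n → b < n → i ≡ i′ × a ≡ b
divMod-unique n zero    zero     a b eq _   _   = refl , eq
divMod-unique n zero    (suc i′) a b eq a<n _   =
  ⊥-elim (<⇒≱ a<n (≤-trans (m≤m+n n (i′ * n + b))
                            (≤-reflexive (trans (sym (+-assoc n _ b)) (sym eq)))))
divMod-unique n (suc i) zero     a b eq _   b<n =
  ⊥-elim (<⇒≱ b<n (≤-trans (m≤m+n n (i * n + a))
                            (≤-reflexive (trans (sym (+-assoc n _ a)) eq))))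
divMod-unique n (suc i) (suc i′) a b eq a<n b<n
  with divMod-unique n i i′ a b
         (+-cancelˡ-≡ n _ _ (trans (sym (+-assoc n _ a)) (trans eq (+-assoc n _ b)))) a<n b<n
... | refl , a≡b = refl , a≡b

row-above : ∀ n i a → suc i * n + a ∸ n ≡ i * n + a
row-above n i a = trans (cong (_∸ n) (+-assoc n (i * n) a)) (m+n∸m≡n n _)

memRow-bounded : ∀ {N} (r : Vec Bool N) j → memRow r j ≡ true → 1 ≤ j × j ≤ N
memRow-bounded (b ∷ bs) (suc zero)    _ = s≤s z≤n , s≤s z≤n
memRow-bounded (b ∷ bs) (suc (suc j)) e = s≤s z≤n , s≤s (proj₂ (memRow-bounded bs (suc j) e))

mem-bounded : ∀ {d N} (I : Subset d N) i j → mem I i j ≡ true →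
              (1 ≤ i × i ≤ d) × (1 ≤ j × j ≤ N)
mem-bounded (r ∷ rs) (suc zero)    j e = (s≤s z≤n , s≤s z≤n) , memRow-bounded r j e
mem-bounded (r ∷ rs) (suc (suc i)) j e with mem-bounded rs (suc i) j e
... | (_ , i≤d) , j-bounds = (s≤s z≤n , s≤s i≤d) , j-bounds

matrix-ext : ∀ {d N} (I J : Subset d N) →
             (∀ i j → i < d → j < N → mem I (suc i) (suc j) ≡ mem J (suc i) (suc j)) → I ≡ J
matrix-ext []       []       _  = refl
matrix-ext (r ∷ rs) (s ∷ ss) eq =
  cong₂ _∷_ (row-ext r s (λ j → eq 0 j z<s))
            (matrix-ext rs ss (λ i j i<d → eq (suc i) j (s≤s i<d)))
  where
  row-ext : ∀ {N} (r s : Vec Bool N) →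
            (∀ j → j < N → memRow r (suc j) ≡ memRow s (suc j)) → r ≡ s
  row-ext []       []       _  = refl
  row-ext (b ∷ bs) (c ∷ cs) eq =
    cong₂ _∷_ (eq 0 z<s) (row-ext bs cs (λ j j<N → eq (suc j) (s≤s j<N)))

tabulateRow : ∀ N → (ℕ → Bool) → Vec Bool N
tabulateRow N g = Vec.tabulate (g ∘ toℕ)

tabulateMatrix : ∀ d N → (ℕ → ℕ → Bool) → Subset d N
tabulateMatrix d N f = Vec.tabulate (λ i → tabulateRow N (f (toℕ i)))

memRow-tabulate : ∀ N g j → j < N → memRow (tabulateRow N g) (suc j) ≡ g j
memRow-tabulate (suc N) g zero    _         = refl
memRow-tabulate (suc N) g (suc j) (s≤s j<N) = memRow-tabulate N (g ∘ suc) j j<N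

mem-tabulate : ∀ d N f i j → i < d → j < N →
               mem (tabulateMatrix d N f) (suc i) (suc j) ≡ f i j
mem-tabulate (suc d) N f zero    j _         j<N = memRow-tabulate N (f 0) j j<N
mem-tabulate (suc d) N f (suc i) j (s≤s i<d) j<N = mem-tabulate d N (f ∘ suc) i j i<d j<N

-- The numbers (i - 1) n + j of the cells (i , j) of a Boolean matrix, listed in
-- decreasing order; i0 is the 0-based index of the current row and col the
-- 1-based index of the current column during the recursion.
rowCells : ∀ {N} → ℕ → ℕ → ℕ → Vec Bool N → List ℕ
rowCells n i0 col []           = []
rowCells n i0 col (true ∷ bs)  = rowCells n i0 (suc col) bs ++ [ i0 * n + col ]
rowCells n i0 col (false ∷ bs) = rowCells n i0 (suc col) bs

cellsFrom : ∀ {d N} → ℕ → ℕ → Subset d N → List ℕ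
cellsFrom n i0 []       = []
cellsFrom n i0 (r ∷ rs) = cellsFrom n (suc i0) rs ++ rowCells n i0 1 r

cells : ∀ {d N} → ℕ → Subset d N → List ℕ
cells n I = cellsFrom n 0 I

sum-cells : ∀ {d N} n (I : Subset d N) → sum (cells n I) ≡ weight n I
sum-cells n I = sum-cellsFrom 0 I
  where
  sum-rowCells : ∀ {N} i0 j0 (r : Vec Bool N) →
                 sum (rowCells n i0 (suc j0) r) ≡ weightRow n i0 j0 r
  sum-rowCells i0 j0 []           = refl
  sum-rowCells i0 j0 (true ∷ bs)  =
    trans (sum-++ (rowCells n i0 (suc (suc j0)) bs) _)
          (trans (cong₂ _+_ (sum-rowCells i0 (suc j0) bs) (+-identityʳ _))
                 (+-comm (weightRow n i0 (suc j0) bs) _))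
  sum-rowCells i0 j0 (false ∷ bs) = sum-rowCells i0 (suc j0) bs
  sum-cellsFrom : ∀ {d N} i0 (I : Subset d N) → sum (cellsFrom n i0 I) ≡ weightFrom n i0 I
  sum-cellsFrom i0 []       = refl
  sum-cellsFrom i0 (r ∷ rs) =
    trans (sum-++ (cellsFrom n (suc i0) rs) _)
          (trans (cong₂ _+_ (sum-cellsFrom (suc i0) rs) (sum-rowCells i0 0 r))
                 (+-comm (weightFrom n (suc i0) rs) _))

length-cells : ∀ {d N} n (I : Subset d N) → length (cells n I) ≡ card I
length-cells n I = length-cellsFrom 0 I
  where
  length-rowCells : ∀ {N} i0 col (r : Vec Bool N) → length (rowCells n i0 col r) ≡ cardRow r
  length-rowCells i0 col []           = refl
  length-rowCells i0 col (true ∷ bs)  =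
    trans (List.length-++ (rowCells n i0 (suc col) bs))
          (trans (+-comm _ 1) (cong suc (length-rowCells i0 (suc col) bs)))
  length-rowCells i0 col (false ∷ bs) = length-rowCells i0 (suc col) bs
  length-cellsFrom : ∀ {d N} i0 (I : Subset d N) → length (cellsFrom n i0 I) ≡ card I
  length-cellsFrom i0 []       = refl
  length-cellsFrom i0 (r ∷ rs) =
    trans (List.length-++ (cellsFrom n (suc i0) rs))
          (trans (cong₂ _+_ (length-cellsFrom (suc i0) rs) (length-rowCells i0 1 r))
                 (+-comm (card rs) _))

∈rowCells⇒ : ∀ {N} n i0 col (r : Vec Bool N) {v} → v ∈ rowCells n i0 col r →
             ∃ λ j → memRow r (suc j) ≡ true × v ≡ i0 * n + (col + j)
∈rowCells⇒ n i0 col (true ∷ bs) v∈ with ∈-++⁻ (rowCells n i0 (suc col) bs) v∈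
... | inj₂ (here refl) = 0 , refl , cong (i0 * n +_) (sym (+-identityʳ col))
... | inj₁ v∈′ with ∈rowCells⇒ n i0 (suc col) bs v∈′
...   | j , e , refl = suc j , e , cong (i0 * n +_) (sym (+-suc col j))
∈rowCells⇒ n i0 col (false ∷ bs) v∈ with ∈rowCells⇒ n i0 (suc col) bs v∈
... | j , e , refl = suc j , e , cong (i0 * n +_) (sym (+-suc col j))

∈rowCells⇐ : ∀ {N} n i0 col (r : Vec Bool N) j → memRow r (suc j) ≡ true →
             i0 * n + (col + j) ∈ rowCells n i0 col r
∈rowCells⇐ n i0 col (true ∷ bs) zero e =
  ∈-++⁺ʳ (rowCells n i0 (suc col) bs) (here (cong (i0 * n +_) (+-identityʳ col)))
∈rowCells⇐ n i0 col (b ∷ bs) (suc j) e =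
  subst (_∈ rowCells n i0 col (b ∷ bs)) (cong (i0 * n +_) (sym (+-suc col j))) (inTail b)
  where
  inTail : ∀ b → i0 * n + (suc col + j) ∈ rowCells n i0 col (b ∷ bs)
  inTail true  = ∈-++⁺ˡ (∈rowCells⇐ n i0 (suc col) bs j e)
  inTail false = ∈rowCells⇐ n i0 (suc col) bs j e

∈cellsFrom⇒ : ∀ {d N} n i0 (I : Subset d N) {v} → v ∈ cellsFrom n i0 I →
              ∃₂ λ i j → mem I (suc i) (suc j) ≡ true × v ≡ (i0 + i) * n + suc j
∈cellsFrom⇒ n i0 (r ∷ rs) v∈ with ∈-++⁻ (cellsFrom n (suc i0) rs) v∈
... | inj₂ v∈r with ∈rowCells⇒ n i0 1 r v∈r
...   | j , e , refl = 0 , j , e , cong (λ i → i * n + suc j) (sym (+-identityʳ i0))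
∈cellsFrom⇒ n i0 (r ∷ rs) v∈ | inj₁ v∈rs with ∈cellsFrom⇒ n (suc i0) rs v∈rs
...   | i , j , e , refl = suc i , j , e , cong (λ i → i * n + suc j) (sym (+-suc i0 i))

∈cells⇒ : ∀ {d N} n (I : Subset d N) {v} → v ∈ cells n I →
          ∃₂ λ i j → mem I (suc i) (suc j) ≡ true × v ≡ i * n + suc j
∈cells⇒ n = ∈cellsFrom⇒ n 0

∈cells⇐ : ∀ {d N} n (I : Subset d N) i j → mem I (suc i) (suc j) ≡ true →
          i * n + suc j ∈ cells n I
∈cells⇐ n = go 0
  where
  go : ∀ {d N} i0 (I : Subset d N) i j → mem I (suc i) (suc j) ≡ true →
       (i0 + i) * n + suc j ∈ cellsFrom n i0 I
  go i0 (r ∷ rs) zero j e =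
    ∈-++⁺ʳ (cellsFrom n (suc i0) rs)
      (subst (_∈ rowCells n i0 1 r) (cong (λ i → i * n + suc j) (sym (+-identityʳ i0)))
             (∈rowCells⇐ n i0 1 r j e))
  go i0 (r ∷ rs) (suc i) j e =
    ∈-++⁺ˡ (subst (_∈ cellsFrom n (suc i0) rs) (cong (λ i → i * n + suc j) (sym (+-suc i0 i)))
                  (go (suc i0) rs i j e))

cells-decreasing : ∀ {d N} n → N ≤ n → (I : Subset d N) → StrictlyDecreasing (cells n I)
cells-decreasing {N = N} n N≤n = cellsFrom-decreasing 0
  where
  rowCells-decreasing : ∀ {N} i0 col (r : Vec Bool N) → StrictlyDecreasing (rowCells n i0 col r)
  rowCells-decreasing i0 col []           = []
  rowCells-decreasing i0 col (false ∷ bs) = rowCells-decreasing i0 (suc col) bs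
  rowCells-decreasing i0 col (true ∷ bs)  =
    AllPairs.++⁺ (rowCells-decreasing i0 (suc col) bs) ([] ∷ []) (All.tabulate later>)
    where
    later> : ∀ {x} → x ∈ rowCells n i0 (suc col) bs → All (x >_) [ i0 * n + col ]
    later> x∈ with ∈rowCells⇒ n i0 (suc col) bs x∈
    ... | j , _ , refl = +-monoʳ-< (i0 * n) (s≤s (m≤m+n col j)) ∷ []
  cellsFrom-decreasing : ∀ {d} i0 (I : Subset d N) → StrictlyDecreasing (cellsFrom n i0 I)
  cellsFrom-decreasing i0 []       = []
  cellsFrom-decreasing i0 (r ∷ rs) =
    AllPairs.++⁺ (cellsFrom-decreasing (suc i0) rs) (rowCells-decreasing i0 1 r)
                 (All.tabulate higherRows>)
    where
    higherRows> : ∀ {x} → x ∈ cellsFrom n (suc i0) rs → All (x >_) (rowCells n i0 1 r)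
    higherRows> {x} x∈ = All.tabulate row<x
      where
      row<x : ∀ {y} → y ∈ rowCells n i0 1 r → x > y
      row<x y∈ with ∈rowCells⇒ n i0 1 r y∈ | ∈cellsFrom⇒ n (suc i0) rs x∈
      ... | j , e , refl | i , j′ , _ , refl = begin-strict
        i0 * n + suc j            ≤⟨ +-monoʳ-≤ (i0 * n) (≤-trans 1+j≤N N≤n) ⟩
        i0 * n + n                ≡⟨ +-comm (i0 * n) n ⟩
        suc i0 * n                ≤⟨ *-monoˡ-≤ n (m≤m+n (suc i0) i) ⟩
        (suc i0 + i) * n          <⟨ m<m+n _ z<s ⟩
        (suc i0 + i) * n + suc j′ ∎
        where
        open ≤-Reasoning
        1+j≤N : suc j ≤ N
        1+j≤N = proj₂ (memRow-bounded r (suc j) e)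

∈cells⇒mem : ∀ {d N} n → N < n → (I : Subset d N) → ∀ i j → j < N →
             i * n + suc j ∈ cells n I → mem I (suc i) (suc j) ≡ true
∈cells⇒mem n N<n I i j j<N v∈ with ∈cells⇒ n I v∈
... | i′ , j′ , e , eq with mem-bounded I (suc i′) (suc j′) e
...   | _ , (_ , j′<N)
  with divMod-unique n i i′ (suc j) (suc j′) eq (≤-<-trans j<N N<n) (≤-<-trans j′<N N<n)
...     | refl , refl = e

multiple∉cells : ∀ {d N} n → N < n → (I : Subset d N) → ∀ i → i * n ∉ cells n I
multiple∉cells n N<n I i v∈ with ∈cells⇒ n I v∈
... | i′ , j′ , e , eq with mem-bounded I (suc i′) (suc j′) e
...   | _ , (_ , j′<N)
  with divMod-unique n i i′ 0 (suc j′) (trans (+-identityʳ _) eq) (≤-<-trans z≤n N<n) (≤-<-trans j′<N N<n)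
...     | _ , ()

matrixOf : ∀ d N → ℕ → List ℕ → Subset d N
matrixOf d N n H = tabulateMatrix d N (λ i j → does (i * n + suc j ∈? H))

mem-matrixOf : ∀ d N n H i j → i < d → j < N →
               mem (matrixOf d N n H) (suc i) (suc j) ≡ does (i * n + suc j ∈? H)
mem-matrixOf d N n H = mem-tabulate d N (λ i j → does (i * n + suc j ∈? H))

matrixOf-cells : ∀ {d N} n → N < n → (I : Subset d N) → matrixOf d N n (cells n I) ≡ I
matrixOf-cells {d} {N} n N<n I = matrix-ext _ I entry
  where
  entry : ∀ i j → i < d → j < N →
          mem (matrixOf d N n (cells n I)) (suc i) (suc j) ≡ mem I (suc i) (suc j)
  entry i j i<d j<N with mem I (suc i) (suc j) in e
  ... | true  = trans (mem-matrixOf d N n (cells n I) i j i<d j<N)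
                      (dec-true (_ ∈? cells n I) (∈cells⇐ n I i j e))
  ... | false = trans (mem-matrixOf d N n (cells n I) i j i<d j<N)
                      (dec-false (_ ∈? cells n I)
                        (λ v∈ → contradiction (trans (sym e) (∈cells⇒mem n N<n I i j j<N v∈)) λ ()))

mem-matrixOf⇔ : ∀ d N n H i j → i < d → j < N →
                mem (matrixOf d N n H) (suc i) (suc j) ≡ true ⇔ i * n + suc j ∈ H
mem-matrixOf⇔ d N n H i j i<d j<N = mk⇔
  (λ e → invert (subst (Reflects _) (trans (sym (mem-matrixOf d N n H i j i<d j<N)) e)
                       (proof (_ ∈? H))))
  (λ v∈ → trans (mem-matrixOf d N n H i j i<d j<N) (dec-true (_ ∈? H) v∈))

cells-matrixOf : ∀ {d N} n → N < n → ∀ H → StrictlyDecreasing H →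
                 (∀ v → v ∈ H → ∃₂ λ i j → i < d × j < N × v ≡ i * n + suc j) →
                 cells n (matrixOf d N n H) ≡ H
cells-matrixOf {d} {N} n N<n H decreasing is-cell =
  decreasing-ext (cells-decreasing n (<⇒≤ N<n) I) decreasing (mk⇔ cell⇒ ⇒cell)
  where
  I : Subset d N
  I = matrixOf d N n H
  cell⇒ : ∀ {v} → v ∈ cells n I → v ∈ H
  cell⇒ v∈ with ∈cells⇒ n I v∈
  ... | i , j , e , refl with mem-bounded I (suc i) (suc j) e
  ...   | (_ , i<d) , (_ , j<N) = to (mem-matrixOf⇔ d N n H i j i<d j<N) e
  ⇒cell : ∀ {v} → v ∈ H → v ∈ cells n I
  ⇒cell {v} v∈ with is-cell v v∈
  ... | i , j , i<d , j<N , refl = ∈cells⇐ n I i j (from (mem-matrixOf⇔ d N n H i j i<d j<N) v∈)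

-- The size of the partition with a separated β-set H is Σ H - triangle |H|;
-- for H the cells of I this is exactly the summand of the theorem.
rhsTerm-cells : ∀ {d N} n (I : Subset d N) → SeparatedSet (cells n I) →
                ℤ.+ size (unβ (cells n I)) ≡ rhsTerm n I
rhsTerm-cells n I sep = sym (begin
  ℤ.+ weight n I ℤ.- ℤ.+ ((card I * card I ∸ card I) / 2)
    ≡⟨ cong₂ (λ a b → ℤ.+ a ℤ.- ℤ.+ b) (sym total) (sym correction) ⟩
  ℤ.+ (s + T) ℤ.- ℤ.+ T   ≡⟨ ℤ.[+m]-[+n]≡m⊖n (s + T) T ⟩
  (s + T) ⊖ T             ≡⟨ ℤ.⊖-≥ (m≤n+m T s) ⟩
  ℤ.+ (s + T ∸ T)         ≡⟨ cong ℤ.+_ (m+n∸n≡m s T) ⟩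
  ℤ.+ s                   ∎)
  where
  open ≡-Reasoning
  H : List ℕ
  H = cells n I
  s T : ℕ
  s = size (unβ H)
  T = triangle (length (unβ H))
  total : s + T ≡ weight n I
  total = trans (sym (sum-β (unβ H))) (trans (cong sum (β-unβ H sep)) (sum-cells n I))
  correction : T ≡ (card I * card I ∸ card I) / 2
  correction = trans (cong triangle (trans (length-unβ H) (length-cells n I)))
                     (sym (triangle-closed-form (card I)))

-- Two duplicate-free enumerations of the same predicate are permutations of
-- each other; this is what makes the sums in the theorem well defined.
enumerations-↭ : {A : Set} {P : A → Set} {L L′ : List A} →
                 Enumerates P L → Enumerates P L′ → L ↭ L′
enumerations-↭ (u , e) (u′ , e′) =
  ∼bag⇒↭ (unique∧set⇒bag u u′
            (λ {x} → mk⇔ (from (e′ x) ∘ to (e x)) (from (e x) ∘ to (e′ x))))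

sumℤ-↭ : {xs ys : List ℤ} → xs ↭ ys → sumℤ xs ≡ sumℤ ys
sumℤ-↭ p = foldr-commMonoid +-0.setoid +-0.isCommutativeMonoid (↭⇒↭ₛ p)
  where module +-0 = CommutativeMonoid ℤ.+-0-commutativeMonoid

sumℤ-map-cong : {A : Set} (f g : A → ℤ) (xs : List A) →
                (∀ x → x ∈ xs → f x ≡ g x) → sumℤ (map f xs) ≡ sumℤ (map g xs)
sumℤ-map-cong f g []       _  = refl
sumℤ-map-cong f g (x ∷ xs) eq =
  cong₂ ℤ._+_ (eq x (here refl)) (sumℤ-map-cong f g xs (λ y y∈ → eq y (there y∈)))

map-unique : {A B : Set} {P : A → Set} (f : A → B) (xs : List A) → Unique xs →
             (∀ x → x ∈ xs → P x) → (∀ x y → P x → P y → f x ≡ f y → x ≡ y) →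
             Unique (map f xs)
map-unique f []       _        _  _   = []
map-unique f (x ∷ xs) (x∉ ∷ u) Pxs inj =
  All.tabulate distinct ∷ map-unique f xs u (λ y y∈ → Pxs y (there y∈)) inj
  where
  distinct : ∀ {z} → z ∈ map f xs → f x ≢ z
  distinct z∈ fx≡ with ∈-map⁻ f z∈
  ... | y , y∈ , refl =
    All.lookup x∉ y∈ (inj x y (Pxs x (here refl)) (Pxs y (there y∈)) fx≡)

filter-enumerates : {A : Set} {P : A → Set} (P? : ∀ x → Dec (P x)) (xs : List A) →
                    Unique xs → (∀ x → x ∈ xs) → Enumerates P (filter P? xs)
filter-enumerates P? xs u complete =
  Unique.filter⁺ P? u ,
  λ x → mk⇔ (proj₂ ∘ ∈-filter⁻ P? {xs = xs}) (∈-filter⁺ P? (complete x))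

allVectors : {A : Set} → List A → (d : ℕ) → List (Vec A d)
allVectors xs zero    = [] ∷ []
allVectors xs (suc d) = map (λ (a , v) → a ∷ v) (cartesianProduct xs (allVectors xs d))

allVectors-complete : {A : Set} (xs : List A) → (∀ a → a ∈ xs) →
                      (d : ℕ) (v : Vec A d) → v ∈ allVectors xs d
allVectors-complete xs complete zero    []      = here refl
allVectors-complete xs complete (suc d) (a ∷ v) =
  ∈-map⁺ _ (∈-cartesianProduct⁺ (complete a) (allVectors-complete xs complete d v))

allVectors-unique : {A : Set} (xs : List A) → Unique xs → (d : ℕ) → Unique (allVectors xs d)
allVectors-unique xs u zero    = [] ∷ []
allVectors-unique xs u (suc d) =
  Unique.map⁺ ∷-injective (Unique.cartesianProduct⁺ u (allVectors-unique xs u d))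
  where
  ∷-injective : ∀ {p q} → proj₁ p ∷ proj₂ p ≡ proj₁ q ∷ proj₂ q → p ≡ q
  ∷-injective {_ , _} {_ , _} eq with Vec.∷-injective eq
  ... | refl , refl = refl

allMatrices : (d N : ℕ) → List (Subset d N)
allMatrices d N = allVectors (allVectors (true ∷ false ∷ []) N) d

allMatrices-complete : (d N : ℕ) (I : Subset d N) → I ∈ allMatrices d N
allMatrices-complete d N =
  allVectors-complete _ (allVectors-complete _ bool∈ N) d
  where
  bool∈ : (b : Bool) → b ∈ true ∷ false ∷ []
  bool∈ true  = here refl
  bool∈ false = there (here refl)

allMatrices-unique : (d N : ℕ) → Unique (allMatrices d N)
allMatrices-unique d N =
  allVectors-unique _ (allVectors-unique _ (((λ ()) ∷ []) ∷ [] ∷ []) N) d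

-- Both niceness conditions only concern entries inside the matrix, so they
-- are decidable by bounded search; hence membership in B⁻ is decidable.
InB? : (d N : ℕ) (I : Subset d N) → Dec (InB d N I)
InB? d N I = map′ unbound bound ((columns? ×-dec rowOne?) ×-dec (mem I d N Bool.≟ false))
  where
  ColumnsBounded RowOneBounded : Set
  ColumnsBounded = ∀ {i} → i < d → ∀ {j} → j < suc N →
                   1 ≤ i → mem I (suc i) j ≡ true → mem I i j ≡ true
  RowOneBounded  = ∀ {j} → j < suc (N ∸ 1) →
                   1 ≤ j → j ≤ N ∸ 1 → mem I 1 j ≡ true → mem I 1 (suc j) ≡ false

  columns? : Dec ColumnsBounded
  columns? = allUpTo? (λ i → allUpTo? (λ j → (1 ≤? i) →-dec
               ((mem I (suc i) j Bool.≟ true) →-dec (mem I i j Bool.≟ true))) (suc N)) d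
  rowOne? : Dec RowOneBounded
  rowOne? = allUpTo? (λ j → (1 ≤? j) →-dec ((j ≤? N ∸ 1) →-dec
              ((mem I 1 j Bool.≟ true) →-dec (mem I 1 (suc j) Bool.≟ false)))) (suc (N ∸ 1))

  unbound : (ColumnsBounded × RowOneBounded) × mem I d N ≡ false → InB d N I
  unbound ((columns , rowOne) , corner) =
    (columns′ , λ j 1≤j j≤ → rowOne (s≤s j≤) 1≤j j≤) , corner
    where
    columns′ : ∀ i j → 1 ≤ i → mem I (suc i) j ≡ true → mem I i j ≡ true
    columns′ i j 1≤i e with mem-bounded I (suc i) j e
    ... | (_ , i<d) , (_ , j≤N) = columns i<d (s≤s j≤N) 1≤i e

  bound : InB d N I → (ColumnsBounded × RowOneBounded) × mem I d N ≡ false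
  bound ((columns , rowOne) , corner) = ((λ _ _ → columns _ _) , (λ _ → rowOne _)) , corner

B-enumeration : ∀ d N → Enumerates (InB d N) (filter (InB? d N) (allMatrices d N))
B-enumeration d N =
  filter-enumerates (InB? d N) (allMatrices d N) (allMatrices-unique d N) (allMatrices-complete d N)

down-to-first-row : ∀ {d N} (I : Subset d N) → Nice I → ∀ i j →
                    mem I (suc i) j ≡ true → mem I 1 j ≡ true
down-to-first-row I nice zero    j e = e
down-to-first-row I nice (suc i) j e =
  down-to-first-row I nice i j (proj₁ nice (suc i) j (s≤s z≤n) e)

-- The correspondence for fixed n = m + 2 and d = d′ + 1 (so n ≥ 2 and d ≥ 1
-- hold by construction); matrices have N = n - 1 columns and t = d n - 1 is
-- the number of the corner cell (d , N).
module Correspondence (m d′ : ℕ) where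

  n N d t : ℕ
  n = suc (suc m)
  N = suc m
  d = suc d′
  t = d * n ∸ 1

  N<n : N < n
  N<n = ≤-refl

  1≤n : 1 ≤ n
  1≤n = s≤s z≤n

  1≤t : 1 ≤ t
  1≤t = s≤s z≤n

  t≡corner : t ≡ d′ * n + N
  t≡corner = +-comm N (d′ * n)

  F : Subset d N → List ℕ
  F I = unβ (cells n I)

  cells-closed : ∀ (I : Subset d N) → Nice I → Closed n (cells n I)
  cells-closed I nice v v∈ n≤v with ∈cells⇒ n I v∈
  ... | zero , j , e , refl =
    ⊥-elim (<⇒≱ (≤-<-trans (proj₂ (proj₂ (mem-bounded I 1 (suc j) e))) N<n) n≤v)
  ... | suc i , j , e , refl =
    subst (_∈ cells n I) (sym (row-above n i (suc j)))
          (∈cells⇐ n I i j (proj₁ nice (suc i) (suc j) (s≤s z≤n) e))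

  -- … and niceness (2) forbids two consecutive cell numbers: neighbours in a
  -- row would give neighbours in the first row, and the number after the
  -- last column is a multiple of n.
  cells-noConsecutive : ∀ (I : Subset d N) → Nice I → NoConsecutive (cells n I)
  cells-noConsecutive I nice v v∈ 1+v∈ with ∈cells⇒ n I v∈
  ... | i , j , e , refl
    with m≤n⇒m<n∨m≡n (s≤s (proj₂ (proj₂ (mem-bounded I (suc i) (suc j) e))))
  ...   | inj₁ 2+j<n = contradiction (trans (sym forbidden) (first-row next)) λ ()
    where
    first-row : ∀ {j} → mem I (suc i) j ≡ true → mem I 1 j ≡ true
    first-row = down-to-first-row I nice i _
    next : mem I (suc i) (suc (suc j)) ≡ true
    next = ∈cells⇒mem n N<n I i (suc j) (s≤s⁻¹ 2+j<n)
             (subst (_∈ cells n I) (sym (+-suc (i * n) (suc j))) 1+v∈)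
    forbidden : mem I 1 (suc (suc j)) ≡ false
    forbidden = proj₂ nice (suc j) (s≤s z≤n) (s≤s⁻¹ (s≤s⁻¹ 2+j<n)) (first-row e)
  ...   | inj₂ 2+j≡n = multiple∉cells n N<n I (suc i) (subst (_∈ cells n I) 1+v≡ 1+v∈)
    where
    1+v≡ : suc (i * n + suc j) ≡ suc i * n
    1+v≡ = trans (sym (+-suc (i * n) (suc j))) (trans (cong (i * n +_) 2+j≡n) (+-comm (i * n) n))

  -- For I ∈ B⁻ every cell number is below the corner number t, since the
  -- corner cell itself is excluded.
  cells<t : ∀ (I : Subset d N) → InB d N I → ∀ v → v ∈ cells n I → v < t
  cells<t I (_ , corner) v v∈ with ∈cells⇒ n I v∈
  ... | i , j , e , refl with mem-bounded I (suc i) (suc j) e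
  ...   | (_ , i<d) , (_ , j<N) = ≤∧≢⇒< v≤t v≢t
    where
    v≤t : i * n + suc j ≤ t
    v≤t = ≤-trans (+-mono-≤ (*-monoˡ-≤ n (s≤s⁻¹ i<d)) j<N) (≤-reflexive (sym t≡corner))
    v≢t : i * n + suc j ≢ t
    v≢t eq with divMod-unique n i d′ (suc j) N (trans eq t≡corner) (≤-<-trans j<N N<n) N<n
    ... | refl , refl = contradiction (trans (sym corner) e) λ ()

  cells-separated : ∀ (I : Subset d N) → Nice I → SeparatedSet (cells n I)
  cells-separated I nice =
    noConsecutive⇒separated _ (cells-decreasing n (<⇒≤ N<n) I) (cells-noConsecutive I nice) ,
    All.tabulate positive
    where
    positive : ∀ {v} → v ∈ cells n I → 0 < v
    positive v∈ with ∈cells⇒ n I v∈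
    ... | i , j , _ , refl = ≤-trans (s≤s z≤n) (m≤n+m (suc j) (i * n))

  β-F : ∀ (I : Subset d N) → Nice I → β (F I) ≡ cells n I
  β-F I nice = β-unβ (cells n I) (cells-separated I nice)

  -- … so F I is a strict partition whose β-set is n-closed and (vacuously)
  -- t-closed: F I ∈ C.
  F-inC : ∀ (I : Subset d N) → InB d N I → InC n d (F I)
  F-inC I inB@(nice , _) =
    (Linked.map <⇒≤ decreasing , positive) , decreasing ,
    from (core⇔closed n 1≤n (F I) (linked⇒decreasing decreasing))
         (subst (Closed n) (sym (β-F I nice)) (cells-closed I nice)) ,
    from (core⇔closed t 1≤t (F I) (linked⇒decreasing decreasing))
         (subst (Closed t) (sym (β-F I nice))
                (λ v v∈ t≤v → ⊥-elim (<⇒≱ (cells<t I inB v v∈) t≤v)))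
    where
    decreasing : Linked _>_ (F I)
    decreasing = proj₁ (unβ-strict (cells n I) (cells-separated I nice))
    positive : All (0 <_) (F I)
    positive = proj₂ (unβ-strict (cells n I) (cells-separated I nice))

  size-F : ∀ (I : Subset d N) → Nice I → ℤ.+ size (F I) ≡ rhsTerm n I
  size-F I nice = rhsTerm-cells n I (cells-separated I nice)

  F-injective : ∀ (I J : Subset d N) → Nice I → Nice J → F I ≡ F J → I ≡ J
  F-injective I J niceI niceJ eq = begin
    I                           ≡⟨ matrixOf-cells n N<n I ⟨
    matrixOf d N n (cells n I)  ≡⟨ cong (matrixOf d N n) cells≡ ⟩
    matrixOf d N n (cells n J)  ≡⟨ matrixOf-cells n N<n J ⟩
    J                           ∎
    where
    open ≡-Reasoning
    cells≡ : cells n I ≡ cells n J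
    cells≡ = trans (sym (β-F I niceI)) (trans (cong β eq) (β-F J niceJ))

  -- Conversely, the β-set H of a partition μ ∈ C is the cell set of a matrix in B⁻.
  module FromPartition (μ : List ℕ) (inC : InC n d μ) where

    H : List ℕ
    H = β μ

    decreasing : StrictlyDecreasing μ
    decreasing = linked⇒decreasing (proj₁ (proj₂ inC))

    separated : SeparatedSet H
    separated = β-separated μ (proj₁ (proj₂ inC) , proj₂ (proj₁ inC))

    closed-n : Closed n H
    closed-n = to (core⇔closed n 1≤n μ decreasing) (proj₁ (proj₂ (proj₂ inC)))

    closed-t : Closed t H
    closed-t = to (core⇔closed t 1≤t μ decreasing) (proj₂ (proj₂ (proj₂ inC)))

    -- Every v ∈ H is below t: otherwise both v - t and v - d n = v - t - 1
    -- would lie in H, two consecutive numbers.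
    below-t : ∀ v → v ∈ H → v < t
    below-t v v∈ with t ≤? v
    ... | no t≰v = ≰⇒> t≰v
    ... | yes t≤v =
      ⊥-elim (separated⇒noConsecutive H (proj₁ separated) k k∈ (subst (_∈ H) v∸t≡ v∸t∈))
      where
      v∸t∈ : v ∸ t ∈ H
      v∸t∈ = closed-t v v∈ t≤v
      t<v : t < v
      t<v = m∸n≢0⇒n<m (λ v∸t≡0 → <-irrefl (sym v∸t≡0) (All.lookup (proj₂ separated) v∸t∈))
      k : ℕ
      k = v ∸ suc t
      v≡ : v ≡ k + d * n
      v≡ = sym (m∸n+n≡m t<v)
      k∈ : k ∈ H
      k∈ = closed-∸* closed-n d v∈ v≡
      v∸t≡ : v ∸ t ≡ suc k
      v∸t≡ = trans (cong (_∸ t) (trans v≡ (+-suc k t))) (m+n∸n≡m (suc k) t)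

    -- Every v ∈ H is the number i n + (j + 1) of a cell of the d × N box:
    -- its remainder mod n is nonzero since 0 ∉ H, and its quotient is < d as v < t.
    is-cell : ∀ v → v ∈ H → ∃₂ λ i j → i < d × j < N × v ≡ i * n + suc j
    is-cell v v∈ with v % n | m%n<n v n | m≡m%n+[m/n]*n v n
    ... | zero  | _   | v≡ =
      ⊥-elim (<-irrefl refl (All.lookup (proj₂ separated) (closed-∸* closed-n (v / n) v∈ v≡)))
    ... | suc j | r<n | v≡ = v / n , j , quotient<d , s≤s⁻¹ r<n , trans v≡ (+-comm (suc j) _)
      where
      quotient<d : v / n < d
      quotient<d = *-cancelʳ-< n (v / n) d
        (≤-<-trans (≤-trans (m≤n+m _ (suc j)) (≤-reflexive (sym v≡)))
                   (<-trans (below-t v v∈) (n<1+n t)))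

    I : Subset d N
    I = matrixOf d N n H

    mem-I : ∀ i j → i < d → j < N → mem I (suc i) (suc j) ≡ true ⇔ i * n + suc j ∈ H
    mem-I = mem-matrixOf⇔ d N n H

    F-I : F I ≡ μ
    F-I = trans (cong unβ (cells-matrixOf n N<n H (separated⇒decreasing separated) is-cell))
                (unβ-β μ)

    -- and I ∈ B⁻: n-closure of H gives niceness (1), the absence of
    -- consecutive elements gives (2), and t ∉ H excludes the corner.
    I-inB : InB d N I
    I-inB = (columns , firstRow) , corner
      where
      columns : ∀ i j → 1 ≤ i → mem I (suc i) j ≡ true → mem I i j ≡ true
      columns (suc i) j _ e with mem-bounded I (suc (suc i)) j e
      columns (suc i) (suc j) _ e | (_ , 2+i≤d) , (_ , j<N) =
        from (mem-I i j (<-trans (n<1+n i) 2+i≤d) j<N)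
          (subst (_∈ H) (row-above n i (suc j))
            (closed-n _ (to (mem-I (suc i) j 2+i≤d j<N) e)
                        (≤-trans (m≤m+n n (i * n)) (m≤m+n _ (suc j)))))
      firstRow : ∀ j → 1 ≤ j → j ≤ N ∸ 1 → mem I 1 j ≡ true → mem I 1 (suc j) ≡ false
      firstRow (suc j) _ j≤ e with mem I 1 (suc (suc j)) in e′
      ... | false = refl
      ... | true  = ⊥-elim (separated⇒noConsecutive H (proj₁ separated) (suc j)
                      (to (mem-I 0 j z<s (≤-trans j≤ (n≤1+n m))) e)
                      (to (mem-I 0 (suc j) z<s (s≤s j≤)) e′))
      corner : mem I d N ≡ false
      corner with mem I d N in e
      ... | false = refl
      ... | true  =
        ⊥-elim (<-irrefl (sym t≡corner) (below-t _ (to (mem-I d′ m ≤-refl ≤-refl) e)))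

  -- F carries any enumeration of B⁻ to an enumeration of C: it is injective
  -- on B⁻, lands in C, and every μ ∈ C is F of the matrix of its β-set.
  F-enumerates : ∀ M → Enumerates (InB d N) M → Enumerates (InC n d) (map F M)
  F-enumerates M (unique , members) =
    map-unique F M unique (λ I I∈ → to (members I) I∈)
                          (λ I J inI inJ → F-injective I J (proj₁ inI) (proj₁ inJ)) ,
    λ μ → mk⇔ (image μ) (preimage μ)
    where
    image : ∀ μ → μ ∈ map F M → InC n d μ
    image μ μ∈ with ∈-map⁻ F μ∈
    ... | I , I∈ , refl = F-inC I (to (members I) I∈)
    preimage : ∀ μ → InC n d μ → μ ∈ map F M
    preimage μ inC = subst (_∈ map F M) F-I (∈-map⁺ F (from (members I) I-inB))
      where open FromPartition μ inC

-- Lemma 3.4.  Both sides are finite sums (explicit enumerations exist), and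
-- for any enumerations the two sums agree: the enumeration of C may be
-- replaced by the image of that of B⁻ under F, which preserves the summands.
lemma3p4 : (n d k : ℕ) → 2 ≤ n → 1 ≤ d → 1 ≤ k →
    (∃ λ (L : List (List ℕ)) → Enumerates (InC n d) L) ×
    (∃ λ (M : List (Subset d (n ∸ 1))) → Enumerates (InB d (n ∸ 1)) M) ×
    (∀ (L : List (List ℕ)) (M : List (Subset d (n ∸ 1))) →
      Enumerates (InC n d) L → Enumerates (InB d (n ∸ 1)) M →
      sumℤ (map (λ p → (ℤ.+ size p) ^ k) L) ≡ sumℤ (map (λ I → rhsTerm n I ^ k) M))
lemma3p4 (suc (suc m)) (suc d′) k (s≤s (s≤s z≤n)) (s≤s z≤n) _ =
  (map F M₀ , F-enumerates M₀ (B-enumeration d N)) , (M₀ , B-enumeration d N) , sums-agree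
  where
  open Correspondence m d′
  M₀ : List (Subset d N)
  M₀ = filter (InB? d N) (allMatrices d N)
  sizeᵏ : List ℕ → ℤ
  sizeᵏ p = (ℤ.+ size p) ^ k
  sums-agree : ∀ L M → Enumerates (InC n d) L → Enumerates (InB d N) M →
               sumℤ (map sizeᵏ L) ≡ sumℤ (map (λ I → rhsTerm n I ^ k) M)
  sums-agree L M enumL enumM@(_ , members) = begin
    sumℤ (map sizeᵏ L)
      ≡⟨ sumℤ-↭ (↭-map sizeᵏ (enumerations-↭ enumL (F-enumerates M enumM))) ⟩
    sumℤ (map sizeᵏ (map F M))
      ≡⟨ cong sumℤ (List.map-∘ M) ⟨
    sumℤ (map (sizeᵏ ∘ F) M)
      ≡⟨ sumℤ-map-cong _ _ M summand ⟩
    sumℤ (map (λ I → rhsTerm n I ^ k) M)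
      ∎
    where
    open ≡-Reasoning
    summand : ∀ I → I ∈ M → sizeᵏ (F I) ≡ rhsTerm n I ^ k
    summand I I∈ = cong (_^ k) (size-F I (proj₁ (to (members I) I∈)))
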